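{- Let $\{A_n\}_{n\geq 1}$ be a family of nonempty sets with $A_n\subseteq\{0,1,\ldots,n-1\}$ for all $n$, and let $\alpha(n)=|A_n|$. If the family $\{A_n\}_n$ is multiplicative, then $\alpha$ is a multiplicative function, i.e. $\alpha(m_1m_2)=\alpha(m_1)\alpha(m_2)$ whenever $\gcd(m_1,m_2)=1$.
   Context: For $1\leq m\leq n$ with $m\mid n$, $A_n(m)=\{a+jm: a\in A_m,\ 0\leq j<n/m\}$. The family is multiplicative if whenever $n=m_1m_2$ with $\gcd(m_1,m_2)=1$, one has $A_n=A_n(m_1)\cap A_n(m_2)$. -}

module Defs where

open import Data.Nat using (ℕ; suc; _+_; _*_; _<_; _≤_; NonZero)
open import Data.Nat.DivMod using (_/_)
open import Data.Nat.GCD using (gcd)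
open import Data.Fin using (Fin; toℕ)
open import Data.Fin.Subset using (Subset; _∈_)
open import Data.Product using (Σ; _×_; ∃)
open import Relation.Binary.PropositionalEquality using (_≡_)

-- A family of sets A n ⊆ {0,…,n-1}, represented as finite subsets of Fin n.
-- (Only the indices n ≥ 1 are meaningful; the value at n = 0 is irrelevant.)
Family : Set
Family = (n : ℕ) → Subset n

-- Membership in A_n(m) = { a + j m : a ∈ A_m, 0 ≤ j < n/m }  (for m ≥ 1).
_∈A[_]⟨_⟩ : ℕ → Family → (m : ℕ) → .{{NonZero m}} → ℕ → Set
(x ∈A[ A ]⟨ m ⟩) n =
  Σ (Fin m) λ a → a ∈ A m × Σ ℕ λ j → (j < n / m) × (x ≡ toℕ a + j * m)

Multiplicative : Family → Set
Multiplicative A =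
  (m₁ m₂ : ℕ) → .{{_ : NonZero m₁}} → .{{_ : NonZero m₂}} → gcd m₁ m₂ ≡ 1 →
  (x : Fin (m₁ * m₂)) →
  (x ∈ A (m₁ * m₂) → (toℕ x ∈A[ A ]⟨ m₁ ⟩) (m₁ * m₂) × (toℕ x ∈A[ A ]⟨ m₂ ⟩) (m₁ * m₂))
  × ((toℕ x ∈A[ A ]⟨ m₁ ⟩) (m₁ * m₂) × (toℕ x ∈A[ A ]⟨ m₂ ⟩) (m₁ * m₂) → x ∈ A (m₁ * m₂))

-- For x < n and m ∣ n, whether x ∈ A_n(m) depends only on the
-- residue of x modulo m: it holds iff (x mod m) ∈ A m.  Multiplicativity thus
-- says that x ∈ A n iff (x mod m₁) ∈ A m₁ and (x mod m₂) ∈ A m₂, so the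
-- indicator of A n at x is the product of the indicators of A m₁ and A m₂ at
-- the two residues of x.  By uniqueness in the Chinese remainder theorem the
-- map x ↦ (x mod m₁, x mod m₂), encoded back into Fin n by `combine`, is an
-- injective, hence bijective, endomap of Fin n.  Reindexing the sum of
-- indicators along it turns |A n| into a sum over Fin m₁ × Fin m₂ of a
-- product of a function of the first and of the second coordinate, which
-- factors as |A m₁| |A m₂|.
module Submission where

open import Defs
open import Data.Nat using (ℕ; suc; _*_; NonZero)
open import Data.Nat.GCD using (gcd)
open import Data.Fin.Subset using (Nonempty; ∣_∣)
open import Relation.Binary.PropositionalEquality using (_≡_)

open import Data.Nat using (zero; _+_; _∸_; _≤_; _<_)
open import Data.Nat.Properties
open import Data.Nat.DivMod
open import Data.Nat.Divisibility using (_∣_; divides; divides-refl; >⇒∤; m∣m*n; n∣m*n)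
open import Data.Nat.LCM using (lcm; lcm-least; gcd*lcm)
open import Data.Fin as F using (Fin; toℕ; _↑ˡ_; _↑ʳ_; combine; remQuot; punchOut)
open import Data.Fin.Properties
  using (toℕ-injective; toℕ-fromℕ<; toℕ<n; any?; punchOut-injective; injective⇒≤;
         remQuot-combine; combine-injective)
  renaming (_≟_ to _≟ᶠ_)
open import Data.Fin.Subset using (Subset; Side; inside; outside; _∈_; _∉_)
open import Data.Fin.Subset.Properties using (_∈?_)
open import Data.Vec using ([]; _∷_; lookup)
open import Data.Vec.Properties using (lookup⇒[]=; []=⇒lookup)
open import Data.Product using (∃; _×_; _,_; proj₁; proj₂; uncurry)
open import Data.Product.Function.NonDependent.Propositional using (_×-⇔_)
open import Data.Sum using (inj₁; inj₂)
open import Function using (_∘_)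
open import Function.Bundles using (_⇔_; mk⇔; Equivalence; mk↔ₛ′)
open import Function.Definitions using (Injective)
import Function.Properties.Equivalence as ⇔
open import Relation.Binary.PropositionalEquality using (refl; sym; trans; cong; cong₂; subst; module ≡-Reasoning)
open import Relation.Nullary using (¬_; yes; no; contradiction)
open import Algebra.Properties.Semiring.Sum +-*-semiring
  using (sum; sum-cong-≗; sum-permute; *-distribˡ-sum; *-distribʳ-sum)

open Equivalence using (to; from)

𝟙 : Side → ℕ
𝟙 inside  = 1
𝟙 outside = 0

∣p∣≡∑𝟙 : ∀ {n} (p : Subset n) → ∣ p ∣ ≡ sum (λ x → 𝟙 (lookup p x))
∣p∣≡∑𝟙 []            = refl
∣p∣≡∑𝟙 (inside  ∷ p) = cong suc (∣p∣≡∑𝟙 p)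
∣p∣≡∑𝟙 (outside ∷ p) = ∣p∣≡∑𝟙 p

𝟙-∈ : ∀ {n} {p : Subset n} {x} → x ∈ p → 𝟙 (lookup p x) ≡ 1
𝟙-∈ x∈p = cong 𝟙 ([]=⇒lookup x∈p)

𝟙-∉ : ∀ {n} {p : Subset n} {x} → x ∉ p → 𝟙 (lookup p x) ≡ 0
𝟙-∉ {p = p} {x} x∉p with lookup p x in eq
... | inside  = contradiction (lookup⇒[]= x p eq) x∉p
... | outside = refl

𝟙-× : ∀ {k l m} (p : Subset k) (q : Subset l) (r : Subset m) x i j →
      (x ∈ p ⇔ (i ∈ q × j ∈ r)) →
      𝟙 (lookup p x) ≡ 𝟙 (lookup q i) * 𝟙 (lookup r j)
𝟙-× p q r x i j x∈p⇔ with i ∈? q | j ∈? r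
... | yes i∈q | yes j∈r =
  trans (𝟙-∈ (from x∈p⇔ (i∈q , j∈r))) (sym (cong₂ _*_ (𝟙-∈ i∈q) (𝟙-∈ j∈r)))
... | yes i∈q | no j∉r =
  trans (𝟙-∉ (j∉r ∘ proj₂ ∘ to x∈p⇔)) (sym (cong₂ _*_ (𝟙-∈ i∈q) (𝟙-∉ j∉r)))
... | no i∉q  | _ =
  trans (𝟙-∉ (i∉q ∘ proj₁ ∘ to x∈p⇔)) (sym (cong (_* _) (𝟙-∉ i∉q)))

sum-++ : ∀ m n (f : Fin (m + n) → ℕ) →
         sum f ≡ sum (λ i → f (i ↑ˡ n)) + sum (λ j → f (m ↑ʳ j))
sum-++ zero    n f = refl
sum-++ (suc m) n f = trans (cong (f F.zero +_) (sum-++ m n (f ∘ F.suc)))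
                           (sym (+-assoc (f F.zero) _ _))

sum-combine : ∀ m n (f : Fin (m * n) → ℕ) →
              sum f ≡ sum (λ i → sum (λ j → f (combine {m} {n} i j)))
sum-combine zero    n f = refl
sum-combine (suc m) n f =
  trans (sum-++ n (m * n) f)
        (cong (sum (λ j → f (j ↑ˡ (m * n))) +_) (sum-combine m n (λ k → f (n ↑ʳ k))))

_⊗_ : ∀ {m n} → (Fin m → ℕ) → (Fin n → ℕ) → Fin (m * n) → ℕ
_⊗_ {m} {n} a b k = uncurry (λ i j → a i * b j) (remQuot {m} n k)

⊗-combine : ∀ {m n} (a : Fin m → ℕ) (b : Fin n → ℕ) i j →
            (a ⊗ b) (combine i j) ≡ a i * b j
⊗-combine a b i j = cong (uncurry (λ i j → a i * b j)) (remQuot-combine i j)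

sum-⊗ : ∀ {m n} (a : Fin m → ℕ) (b : Fin n → ℕ) → sum (a ⊗ b) ≡ sum a * sum b
sum-⊗ {m} {n} a b = begin
  sum (a ⊗ b)                                            ≡⟨ sum-combine m n (a ⊗ b) ⟩
  sum (λ i → sum (λ j → (a ⊗ b) (combine {m} {n} i j)))  ≡⟨ sum-cong-≗ (λ i → sum-cong-≗ (⊗-combine a b i)) ⟩
  sum (λ i → sum (λ j → a i * b j))                      ≡⟨ sum-cong-≗ (λ i → sym (*-distribˡ-sum (a i) b)) ⟩
  sum (λ i → a i * sum b)                                ≡⟨ sym (*-distribʳ-sum (sum b) a) ⟩
  sum a * sum b                                          ∎
  where open ≡-Reasoning

injective⇒surjective : ∀ {n} {f : Fin n → Fin n} → Injective _≡_ _≡_ f →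
                       ∀ y → ∃ λ x → f x ≡ y
injective⇒surjective {n} {f} f-inj y with any? (λ x → f x ≟ᶠ y)
... | yes hit = hit
injective⇒surjective {suc n} {f} f-inj y | no miss =
  contradiction (injective⇒≤ g-inj) (<-irrefl refl)
  where
  -- f misses y, so it factors through Fin n by deleting y, contradicting injectivity.
  f≢y : ∀ x → ¬ (y ≡ f x)
  f≢y x y≡fx = miss (x , sym y≡fx)
  g : Fin (suc n) → Fin n
  g x = punchOut (f≢y x)
  g-inj : Injective _≡_ _≡_ g
  g-inj gx≡gx′ = f-inj (punchOut-injective (f≢y _) (f≢y _) gx≡gx′)

sum-reindex : ∀ {n} (g : Fin n → ℕ) {f : Fin n → Fin n} → Injective _≡_ _≡_ f →
              sum (g ∘ f) ≡ sum g
sum-reindex g {f} f-inj =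
  sym (sum-permute g (mk↔ₛ′ f f⁻¹ (proj₂ ∘ surj) (λ x → f-inj (proj₂ (surj (f x))))))
  where
  surj : ∀ y → ∃ λ x → f x ≡ y
  surj = injective⇒surjective f-inj
  f⁻¹ : Fin _ → Fin _
  f⁻¹ = proj₁ ∘ surj

%-≡⇒∣∸ : ∀ m .{{_ : NonZero m}} x y → x % m ≡ y % m → m ∣ y ∸ x
%-≡⇒∣∸ m x y x%m≡y%m = divides (y / m ∸ x / m) (begin
  y ∸ x                                       ≡⟨ cong₂ _∸_ (m≡m%n+[m/n]*n y m) (m≡m%n+[m/n]*n x m) ⟩
  (y % m + y / m * m) ∸ (x % m + x / m * m)   ≡⟨ cong (λ r → (y % m + y / m * m) ∸ (r + x / m * m)) x%m≡y%m ⟩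
  (y % m + y / m * m) ∸ (y % m + x / m * m)   ≡⟨ [m+n]∸[m+o]≡n∸o (y % m) _ _ ⟩
  y / m * m ∸ x / m * m                       ≡⟨ sym (*-distribʳ-∸ m (y / m) (x / m)) ⟩
  (y / m ∸ x / m) * m                         ∎)
  where open ≡-Reasoning

coprime⇒*∣ : ∀ {m₁ m₂ d} → gcd m₁ m₂ ≡ 1 → m₁ ∣ d → m₂ ∣ d → m₁ * m₂ ∣ d
coprime⇒*∣ {m₁} {m₂} g m₁∣d m₂∣d = subst (_∣ _) lcm≡* (lcm-least m₁∣d m₂∣d)
  where
  lcm≡* : lcm m₁ m₂ ≡ m₁ * m₂
  lcm≡* = trans (sym (*-identityˡ _)) (trans (cong (_* lcm m₁ m₂) (sym g)) (gcd*lcm m₁ m₂))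

∣∧<⇒≡0 : ∀ {d k} → d ∣ k → k < d → k ≡ 0
∣∧<⇒≡0 {k = zero}  _   _   = refl
∣∧<⇒≡0 {k = suc _} d∣k k<d = contradiction d∣k (>⇒∤ k<d)

-- Below m₁ m₂ with m₁, m₂ coprime, a number is determined by its residues;
-- first for an ordered pair, where the difference is a multiple of m₁ m₂.
crt-unique-≤ : ∀ {m₁ m₂} .{{_ : NonZero m₁}} .{{_ : NonZero m₂}} → gcd m₁ m₂ ≡ 1 →
               ∀ {x y} → x ≤ y → y < m₁ * m₂ →
               x % m₁ ≡ y % m₁ → x % m₂ ≡ y % m₂ → x ≡ y
crt-unique-≤ {m₁} {m₂} g {x} {y} x≤y y<n e₁ e₂ =
  ≤-antisym x≤y (m∸n≡0⇒m≤n (∣∧<⇒≡0 n∣y∸x (≤-<-trans (m∸n≤m y x) y<n)))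
  where
  n∣y∸x : m₁ * m₂ ∣ y ∸ x
  n∣y∸x = coprime⇒*∣ g (%-≡⇒∣∸ m₁ x y e₁) (%-≡⇒∣∸ m₂ x y e₂)

crt-unique : ∀ {m₁ m₂} .{{_ : NonZero m₁}} .{{_ : NonZero m₂}} → gcd m₁ m₂ ≡ 1 →
             ∀ {x y} → x < m₁ * m₂ → y < m₁ * m₂ →
             x % m₁ ≡ y % m₁ → x % m₂ ≡ y % m₂ → x ≡ y
crt-unique g {x} {y} x<n y<n e₁ e₂ with ≤-total x y
... | inj₁ x≤y = crt-unique-≤ g x≤y y<n e₁ e₂
... | inj₂ y≤x = sym (crt-unique-≤ g y≤x x<n (sym e₁) (sym e₂))

crt : ∀ m₁ m₂ .{{_ : NonZero m₁}} .{{_ : NonZero m₂}} → Fin (m₁ * m₂) → Fin (m₁ * m₂)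
crt m₁ m₂ x = combine (toℕ x mod m₁) (toℕ x mod m₂)

mod≡⇒%≡ : ∀ m .{{_ : NonZero m}} {x y} → x mod m ≡ y mod m → x % m ≡ y % m
mod≡⇒%≡ m {x} {y} eq =
  trans (sym (toℕ-fromℕ< (m%n<n x m))) (trans (cong toℕ eq) (toℕ-fromℕ< (m%n<n y m)))

crt-injective : ∀ {m₁ m₂} .{{_ : NonZero m₁}} .{{_ : NonZero m₂}} → gcd m₁ m₂ ≡ 1 →
                Injective _≡_ _≡_ (crt m₁ m₂)
crt-injective {m₁} {m₂} g {x} {y} crt≡ with combine-injective _ _ _ _ crt≡
... | e₁ , e₂ = toℕ-injective
  (crt-unique g (toℕ<n x) (toℕ<n y) (mod≡⇒%≡ m₁ e₁) (mod≡⇒%≡ m₂ e₂))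

/-mono-<-∣ : ∀ {m n x} .{{_ : NonZero m}} → m ∣ n → x < n → x / m < n / m
/-mono-<-∣ {m} {x = x} (divides-refl k) x<km =
  subst (x / m <_) (sym (m*n/n≡m k m)) (m<n*o⇒m/o<n x<km)

mod-shift : ∀ m .{{_ : NonZero m}} (a : Fin m) j → (toℕ a + j * m) mod m ≡ a
mod-shift m a j = toℕ-injective (begin
  toℕ ((toℕ a + j * m) mod m)   ≡⟨ toℕ-fromℕ< (m%n<n (toℕ a + j * m) m) ⟩
  (toℕ a + j * m) % m           ≡⟨ [m+kn]%n≡m%n (toℕ a) j m ⟩
  toℕ a % m                     ≡⟨ m<n⇒m%n≡m (toℕ<n a) ⟩
  toℕ a                         ∎)
  where open ≡-Reasoning

∈A⟨⟩⇔ : (A : Family) → ∀ {m n x} .{{_ : NonZero m}} → m ∣ n → x < n →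
        (x ∈A[ A ]⟨ m ⟩) n ⇔ (x mod m) ∈ A m
∈A⟨⟩⇔ A {m} {n} {x} m∣n x<n = mk⇔ residue∈ decompose
  where
  residue∈ : (x ∈A[ A ]⟨ m ⟩) n → (x mod m) ∈ A m
  residue∈ (a , a∈A , j , _ , refl) = subst (_∈ A m) (sym (mod-shift m a j)) a∈A
  decompose : (x mod m) ∈ A m → (x ∈A[ A ]⟨ m ⟩) n
  decompose x%m∈A = x mod m , x%m∈A , x / m , /-mono-<-∣ m∣n x<n ,
    trans (m≡m%n+[m/n]*n x m) (cong (_+ x / m * m) (sym (toℕ-fromℕ< (m%n<n x m))))

multiplicative⇔ : (A : Family) → Multiplicative A →
  ∀ {m₁ m₂} .{{_ : NonZero m₁}} .{{_ : NonZero m₂}} → gcd m₁ m₂ ≡ 1 →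
  (x : Fin (m₁ * m₂)) →
  x ∈ A (m₁ * m₂) ⇔ ((toℕ x mod m₁) ∈ A m₁ × (toℕ x mod m₂) ∈ A m₂)
multiplicative⇔ A mult {m₁} {m₂} g x =
  ⇔.trans (mk⇔ (proj₁ (mult m₁ m₂ g x)) (proj₂ (mult m₁ m₂ g x)))
          (∈A⟨⟩⇔ A (m∣m*n m₂) (toℕ<n x) ×-⇔ ∈A⟨⟩⇔ A (n∣m*n m₁) (toℕ<n x))

lemma2p1 : (A : Family) →
    (∀ n → .{{_ : NonZero n}} → Nonempty (A n)) →
    Multiplicative A →
    ∀ m₁ m₂ → .{{_ : NonZero m₁}} → .{{_ : NonZero m₂}} → gcd m₁ m₂ ≡ 1 →
    ∣ A (m₁ * m₂) ∣ ≡ ∣ A m₁ ∣ * ∣ A m₂ ∣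
lemma2p1 A _ mult m₁ m₂ g = begin
  ∣ A (m₁ * m₂) ∣                        ≡⟨ ∣p∣≡∑𝟙 (A (m₁ * m₂)) ⟩
  sum (λ x → 𝟙 (lookup (A (m₁ * m₂)) x))  ≡⟨ sum-cong-≗ 𝟙-factors ⟩
  sum ((a ⊗ b) ∘ crt m₁ m₂)               ≡⟨ sum-reindex (a ⊗ b) (crt-injective g) ⟩
  sum (a ⊗ b)                             ≡⟨ sum-⊗ a b ⟩
  sum a * sum b                           ≡⟨ sym (cong₂ _*_ (∣p∣≡∑𝟙 (A m₁)) (∣p∣≡∑𝟙 (A m₂))) ⟩
  ∣ A m₁ ∣ * ∣ A m₂ ∣                     ∎
  where
  open ≡-Reasoning
  a : Fin m₁ → ℕ
  a i = 𝟙 (lookup (A m₁) i)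
  b : Fin m₂ → ℕ
  b j = 𝟙 (lookup (A m₂) j)
  𝟙-factors : ∀ x → 𝟙 (lookup (A (m₁ * m₂)) x) ≡ (a ⊗ b) (crt m₁ m₂ x)
  𝟙-factors x = trans (𝟙-× (A (m₁ * m₂)) (A m₁) (A m₂) x _ _ (multiplicative⇔ A mult g x))
                      (sym (⊗-combine a b _ _))
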